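{- Let $\Delta$ be a matroid on the ground set $[n]$ such that $[d]$ is a basis of $\Delta$. Then $$h(\Delta,x)=\sum_{I} x^{|I|}\,h(\Gamma_I,x),$$ where the sum ranges over all independent sets $I$ of $\Delta$ with $I\subseteq[n]-[d]$ (including $I=\emptyset$).
   Context: For an independent set $I$ with $I\cap[d]=\emptyset$, $\Gamma_I$ is the matroid on $[d]$ whose independent sets are the subsets $G\subseteq[d]$ such that $G\cup I$ is independent in $\Delta$. For a matroid $M$ of rank $r$ with bases $B_1,\dots,B_k$ in a shelling order (e.g. lexicographic), $h(M,x)=\sum_{i=1}^k x^{|\mathcal{R}(B_i)|}$, where $\mathcal{R}(B_i)$ is the minimal subset of $B_i$ not contained in any $B_j$ with $j<i$; equivalently, writing $h(M,x)=\sum_i h_i x^i$ and $f_i$ for the number of independent sets of size $i$, one has $\sum_{i=0}^r h_i y^{r-i}=\sum_{i=0}^r f_i (y-1)^{r-i}$, so $h(M,x)$ is independent of the shelling. -}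

module Defs where

open import Data.Bool using (Bool; true; false)
open import Data.Nat using (ℕ; zero; suc; _∸_; _≤?_; _⊔_)
open import Data.Nat.Combinatorics using (_C_)
open import Data.Integer as ℤ using (ℤ; +_; -1ℤ; 0ℤ)
open import Data.Fin using (Fin)
open import Data.Fin.Subset using (Subset; ∣_∣; _∪_; ⁅_⁆; _⊆_; _∈_; _∉_)
open import Data.Vec using (Vec; []; _∷_; replicate; _++_)
open import Data.List as List using (List; filter; length; upTo)
open import Data.Product using (Σ; _×_; _,_)
open import Relation.Nullary using (Dec; yes; no; ¬_)
open import Relation.Unary using (Pred; Decidable)
open import Relation.Binary.PropositionalEquality using (_≡_)
open import Level using (0ℓ)

record SetSystem (n : ℕ) : Set₁ where
  field
    Indep  : Pred (Subset n) 0ℓ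
    indep? : Decidable Indep
open SetSystem public

record IsMatroid {n : ℕ} (M : SetSystem n) : Set where
  field
    empty-indep : Indep M (replicate n false)
    hereditary  : ∀ A B → A ⊆ B → Indep M B → Indep M A
    exchange    : ∀ A B → Indep M A → Indep M B → ∣ A ∣ Data.Nat.< ∣ B ∣ →
                  Σ (Fin n) λ x → x ∈ B × x ∉ A × Indep M (A ∪ ⁅ x ⁆)

IsBasis : {n : ℕ} → SetSystem n → Subset n → Set
IsBasis M B = Indep M B × (∀ C → Indep M C → B ⊆ C → C ≡ B)

allSubsets : (n : ℕ) → List (Subset n)
allSubsets zero    = [] List.∷ List.[]
allSubsets (suc n) = List.map (true ∷_) (allSubsets n) List.++ List.map (false ∷_) (allSubsets n)

indepSets : {n : ℕ} → SetSystem n → List (Subset n)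
indepSets {n} M = filter (indep? M) (allSubsets n)

fvec : {n : ℕ} → SetSystem n → ℕ → ℕ
fvec M i = length (filter (λ A → ∣ A ∣ Data.Nat.≟ i) (indepSets M))

rank : {n : ℕ} → SetSystem n → ℕ
rank M = List.foldr _⊔_ 0 (List.map ∣_∣ (indepSets M))

Poly : Set
Poly = ℕ → ℤ

polyZero : Poly
polyZero _ = 0ℤ

_+ₚ_ : Poly → Poly → Poly
(p +ₚ q) k = p k ℤ.+ q k

xpow* : ℕ → Poly → Poly
xpow* j p k with j ≤? k
... | yes _ = p (k ∸ j)
... | no  _ = 0ℤ

sumₚ : List Poly → Poly
sumₚ = List.foldr _+ₚ_ polyZero

sumℤ : List ℤ → ℤ
sumℤ = List.foldr ℤ._+_ 0ℤ

-- h-polynomial, defined by  Σ_i h_i y^(r-i) = Σ_i f_i (y-1)^(r-i):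
-- comparing coefficients of y^(r-k) gives
--   h_k = Σ_{i=0}^{k} (-1)^(k-i) * C(r-i, k-i) * f_i .
hpoly : {n : ℕ} → SetSystem n → Poly
hpoly M k = sumℤ (List.map term (upTo (suc k)))
  where
    r = rank M
    term : ℕ → ℤ
    term i = (-1ℤ ℤ.^ (k ∸ i)) ℤ.* ((+ ((r ∸ i) C (k ∸ i))) ℤ.* (+ fvec M i))

-- Ground set [n] = [d + m]; the first d elements form [d].

firstD : (d m : ℕ) → Subset (d Data.Nat.+ m)
firstD d m = replicate d true ++ replicate m false

embedTail : (d : ℕ) {m : ℕ} → Subset m → Subset (d Data.Nat.+ m)
embedTail d I = replicate d false ++ I

Gamma : {d m : ℕ} → SetSystem (d Data.Nat.+ m) → Subset m → SetSystem d
Indep  (Gamma Δ I) G = Indep Δ (G ++ I)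
indep? (Gamma Δ I) G = indep? Δ (G ++ I)

tailIndepSets : (d : ℕ) {m : ℕ} → SetSystem (d Data.Nat.+ m) → List (Subset m)
tailIndepSets d {m} Δ = filter (λ I → indep? Δ (embedTail d I)) (allSubsets m)

-- Expanding Σ hᵢ y^(r−i) = Σ fᵢ (y−1)^(r−i) writes h_k(M) as a sum over the independent sets A
-- of M with |A| ≤ k of the weight (−1)^(k−|A|) C(r−|A|, k−|A|), where r is the rank of M.
-- Every subset of [n] is uniquely G ∪ I with G ⊆ [d] and I ⊆ [n] − [d], and G ∪ I is independent
-- iff I is independent and G is independent in Γ_I. As [d] is a basis, rank Δ = d, and an
-- independent G ∪ I can be augmented from [d] until it has d elements, so rank Γ_I = d − |I|.
-- Hence the weight of G ∪ I for (d, k) is the weight of G for (d − |I|, k − |I|), and it vanishes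
-- when |I| > k; summing over G for a fixed I gives the coefficient of x^k in x^|I| h(Γ_I, x).

module Submission where

open import Defs
open import Data.Nat using (ℕ; _+_)
open import Data.List using (map)
open import Data.Fin.Subset using (∣_∣)
open import Relation.Binary.PropositionalEquality using (_≡_)

open import Data.Bool using (true; false; if_then_else_)
import Data.Bool.Properties as Boolₚ
open import Data.Empty using (⊥-elim)
open import Data.Fin using (Fin) renaming (zero to fzero; suc to fsuc)
open import Data.Fin.Subset using (Subset; ⊥; ⁅_⁆; _∪_; _⊆_; _∈_; _∉_)
import Data.Fin.Subset.Properties as Subsetₚ
open import Data.Integer as ℤ using (ℤ; +_; 0ℤ; 1ℤ; -1ℤ) renaming (_+_ to _+ℤ_; _*_ to _*ℤ_)
import Data.Integer.Properties as ℤₚ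
open import Algebra.Properties.CommutativeSemigroup ℤₚ.+-commutativeSemigroup using (interchange)
open import Data.List using (List; []; _∷_; filter; length; applyUpTo; upTo) renaming (_++_ to _++ˡ_)
open import Data.List.Membership.Propositional using () renaming (_∈_ to _∈ˡ_)
open import Data.List.Membership.Propositional.Properties using (∈-map⁺; ∈-++⁺ˡ; ∈-++⁺ʳ; ∈-filter⁺)
open import Data.List.Properties using (foldr-preservesᵇ; foldr-preservesᵒ)
import Data.List.Relation.Unary.All as All
import Data.List.Relation.Unary.All.Properties as Allₚ
open import Data.List.Relation.Unary.Any as Any using (here)
open import Data.Nat using (zero; suc; _∸_; _≤_; _<_; _≤?_; _<?_; _≟_; z≤n; s≤s)
import Data.Nat.Properties as ℕₚ
open import Data.Nat.Combinatorics using (_C_)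
open import Data.Product using (Σ; _×_; _,_; proj₁; proj₂)
open import Data.Sum using (inj₁; inj₂; [_,_])
open import Data.Vec using ([]; _∷_; replicate; _++_; here; there)
open import Function using (_∘_; id)
open import Level using (0ℓ)
open import Relation.Binary.PropositionalEquality using (refl; sym; trans; cong; cong₂; subst; subst₂; module ≡-Reasoning)
open import Relation.Nullary using (Dec; yes; no; does; ¬_; contradiction)
open import Relation.Unary using (Pred; Decidable)

private
  variable
    A B : Set

Sum : List A → (A → ℤ) → ℤ
Sum xs f = sumℤ (map f xs)

syntax Sum xs (λ x → e) = ∑[ x ← xs ] e

sum-++ : (xs ys : List A) (f : A → ℤ) → Sum (xs ++ˡ ys) f ≡ Sum xs f +ℤ Sum ys f
sum-++ []       ys f = sym (ℤₚ.+-identityˡ _)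
sum-++ (x ∷ xs) ys f = trans (cong (f x +ℤ_) (sum-++ xs ys f)) (sym (ℤₚ.+-assoc (f x) _ _))

sum-map : (g : A → B) (xs : List A) (f : B → ℤ) → Sum (map g xs) f ≡ Sum xs (f ∘ g)
sum-map g []       f = refl
sum-map g (x ∷ xs) f = cong (f (g x) +ℤ_) (sum-map g xs f)

sum-cong : (xs : List A) {f g : A → ℤ} → (∀ x → f x ≡ g x) → Sum xs f ≡ Sum xs g
sum-cong []       f≡g = refl
sum-cong (x ∷ xs) f≡g = cong₂ _+ℤ_ (f≡g x) (sum-cong xs f≡g)

sum-zero : (xs : List A) {f : A → ℤ} → (∀ x → f x ≡ 0ℤ) → Sum xs f ≡ 0ℤ
sum-zero []       f≡0 = refl
sum-zero (x ∷ xs) f≡0 = cong₂ _+ℤ_ (f≡0 x) (sum-zero xs f≡0)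

sum-+ : (xs : List A) (f g : A → ℤ) → ∑[ x ← xs ] (f x +ℤ g x) ≡ Sum xs f +ℤ Sum xs g
sum-+ []       f g = refl
sum-+ (x ∷ xs) f g = trans (cong (f x +ℤ g x +ℤ_) (sum-+ xs f g)) (interchange (f x) (g x) _ _)

sum-*ˡ : (c : ℤ) (xs : List A) (f : A → ℤ) → c *ℤ Sum xs f ≡ ∑[ x ← xs ] (c *ℤ f x)
sum-*ˡ c []       f = ℤₚ.*-zeroʳ c
sum-*ˡ c (x ∷ xs) f = trans (ℤₚ.*-distribˡ-+ c (f x) _) (cong (c *ℤ f x +ℤ_) (sum-*ˡ c xs f))

sum-swap : (xs : List A) (ys : List B) (f : A → B → ℤ) →
           ∑[ x ← xs ] ∑[ y ← ys ] f x y ≡ ∑[ y ← ys ] ∑[ x ← xs ] f x y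
sum-swap []       ys f = sym (sum-zero ys (λ _ → refl))
sum-swap (x ∷ xs) ys f = trans (cong (Sum ys (f x) +ℤ_) (sum-swap xs ys f))
                               (sym (sum-+ ys (f x) (λ y → ∑[ x ← xs ] f x y)))

sumₚ-apply : (xs : List A) (F : A → Poly) (k : ℕ) → sumₚ (map F xs) k ≡ ∑[ x ← xs ] F x k
sumₚ-apply []       F k = refl
sumₚ-apply (x ∷ xs) F k = cong (F x k +ℤ_) (sumₚ-apply xs F k)

infix 5 _if_

_if_ : {P : Set} → ℤ → Dec P → ℤ
z if P? = if does P? then z else 0ℤ

0-if : {P : Set} (P? : Dec P) → 0ℤ if P? ≡ 0ℤ
0-if P? with does P?
... | true  = refl
... | false = refl

if-yes : {P : Set} (z : ℤ) (P? : Dec P) → P → z if P? ≡ z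
if-yes z (yes _) _ = refl
if-yes z (no ¬p) p = contradiction p ¬p

if-no : {P : Set} (z : ℤ) (P? : Dec P) → ¬ P → z if P? ≡ 0ℤ
if-no z (yes p) ¬p = contradiction p ¬p
if-no z (no _)  _  = refl

*-1-if : {P : Set} (c : ℤ) (P? : Dec P) → c *ℤ (1ℤ if P?) ≡ c if P?
*-1-if c P? with does P?
... | true  = ℤₚ.*-identityʳ c
... | false = ℤₚ.*-zeroʳ c

sum-filter : {P : Pred A 0ℓ} (P? : Decidable P) (xs : List A) (f : A → ℤ) →
             ∑[ x ← filter P? xs ] f x ≡ ∑[ x ← xs ] (f x if P? x)
sum-filter P? []       f = refl
sum-filter P? (x ∷ xs) f with does (P? x)
... | true  = cong (f x +ℤ_) (sum-filter P? xs f)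
... | false = trans (sum-filter P? xs f) (sym (ℤₚ.+-identityˡ _))

length-filter-as-sum : {P : Pred A 0ℓ} (P? : Decidable P) (xs : List A) →
                       + length (filter P? xs) ≡ ∑[ x ← xs ] (1ℤ if P? x)
length-filter-as-sum P? []       = refl
length-filter-as-sum P? (x ∷ xs) with does (P? x)
... | true  = cong (1ℤ +ℤ_) (length-filter-as-sum P? xs)
... | false = trans (length-filter-as-sum P? xs) (sym (ℤₚ.+-identityˡ _))

applyUpTo-∘ : (f : ℕ → A) (g : ℕ → ℕ) (n : ℕ) → applyUpTo (f ∘ g) n ≡ map f (applyUpTo g n)
applyUpTo-∘ f g zero    = refl
applyUpTo-∘ f g (suc n) = cong (f (g 0) ∷_) (applyUpTo-∘ f (g ∘ suc) n)

sum-applyUpTo-suc : (K : ℕ) (f : ℕ → ℤ) → Sum (applyUpTo suc K) f ≡ ∑[ i ← upTo K ] f (suc i)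
sum-applyUpTo-suc K f = trans (cong (λ is → Sum is f) (applyUpTo-∘ suc id K)) (sum-map suc (upTo K) f)

sum-upTo-if-≟ : (K : ℕ) (g : ℕ → ℤ) (a : ℕ) → ∑[ i ← upTo K ] (g i if (a ≟ i)) ≡ g a if (a <? K)
sum-upTo-if-≟ zero    g a       = refl
sum-upTo-if-≟ (suc K) g zero    = begin
  g 0 +ℤ ∑[ i ← applyUpTo suc K ] (g i if (0 ≟ i)) ≡⟨ cong (g 0 +ℤ_) (sum-applyUpTo-suc K _) ⟩
  g 0 +ℤ ∑[ i ← upTo K ] (g (suc i) if (0 ≟ suc i)) ≡⟨ cong (g 0 +ℤ_) (sum-zero (upTo K) (λ _ → refl)) ⟩
  g 0 +ℤ 0ℤ                                          ≡⟨ ℤₚ.+-identityʳ (g 0) ⟩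
  g 0                                                ∎
  where open ≡-Reasoning
-- `_if_` only inspects `does`, and `does (suc a ≟ suc i)` reduces to `does (a ≟ i)`.
sum-upTo-if-≟ (suc K) g (suc a) = begin
  0ℤ +ℤ ∑[ i ← applyUpTo suc K ] (g i if (suc a ≟ i)) ≡⟨ ℤₚ.+-identityˡ _ ⟩
  ∑[ i ← applyUpTo suc K ] (g i if (suc a ≟ i))       ≡⟨ sum-applyUpTo-suc K _ ⟩
  ∑[ i ← upTo K ] (g (suc i) if (a ≟ i))              ≡⟨ sum-upTo-if-≟ K (g ∘ suc) a ⟩
  g (suc a) if (a <? K)                               ∎
  where open ≡-Reasoning

hWeight : ℕ → ℕ → ℕ → ℤ
hWeight r k a = (-1ℤ ℤ.^ (k ∸ a)) *ℤ + ((r ∸ a) C (k ∸ a)) if (a <? suc k)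

hpoly-as-weighted-sum : {n : ℕ} (M : SetSystem n) (k : ℕ) →
                        hpoly M k ≡ ∑[ A ← indepSets M ] hWeight (rank M) k ∣ A ∣
hpoly-as-weighted-sum M k = begin
  hpoly M k
    ≡⟨ sum-cong (upTo (suc k)) (λ i → sym (ℤₚ.*-assoc (sign i) _ _)) ⟩
  ∑[ i ← upTo (suc k) ] (c i *ℤ + fvec M i)
    ≡⟨ sum-cong (upTo (suc k)) (λ i → cong (c i *ℤ_) (length-filter-as-sum _ (indepSets M))) ⟩
  ∑[ i ← upTo (suc k) ] (c i *ℤ ∑[ A ← indepSets M ] (1ℤ if (∣ A ∣ ≟ i)))
    ≡⟨ sum-cong (upTo (suc k)) (λ i → trans (sum-*ˡ (c i) (indepSets M) _)
                                            (sum-cong (indepSets M) (λ A → *-1-if (c i) (∣ A ∣ ≟ i)))) ⟩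
  ∑[ i ← upTo (suc k) ] ∑[ A ← indepSets M ] (c i if (∣ A ∣ ≟ i))
    ≡⟨ sum-swap (upTo (suc k)) (indepSets M) _ ⟩
  ∑[ A ← indepSets M ] ∑[ i ← upTo (suc k) ] (c i if (∣ A ∣ ≟ i))
    ≡⟨ sum-cong (indepSets M) (λ A → sum-upTo-if-≟ (suc k) c ∣ A ∣) ⟩
  ∑[ A ← indepSets M ] hWeight (rank M) k ∣ A ∣ ∎
  where
  open ≡-Reasoning
  sign c : ℕ → ℤ
  sign i = -1ℤ ℤ.^ (k ∸ i)
  c i = sign i *ℤ + ((rank M ∸ i) C (k ∸ i))

hWeight-shift : (r k j g : ℕ) → j ≤ k → hWeight (r ∸ j) (k ∸ j) g ≡ hWeight r k (g + j)
hWeight-shift r k j g j≤k with g ≤? k ∸ j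
... | yes g≤k∸j = begin
  hWeight (r ∸ j) (k ∸ j) g
    ≡⟨ if-yes _ (g <? suc (k ∸ j)) (s≤s g≤k∸j) ⟩
  (-1ℤ ℤ.^ (k ∸ j ∸ g)) *ℤ + ((r ∸ j ∸ g) C (k ∸ j ∸ g))
    ≡⟨ cong₂ (λ a b → (-1ℤ ℤ.^ a) *ℤ + (b C a)) (∸-∸ k) (∸-∸ r) ⟩
  (-1ℤ ℤ.^ (k ∸ (g + j))) *ℤ + ((r ∸ (g + j)) C (k ∸ (g + j)))
    ≡⟨ if-yes _ (g + j <? suc k) (s≤s (ℕₚ.m≤o∸n⇒m+n≤o g j≤k g≤k∸j)) ⟨
  hWeight r k (g + j) ∎
  where
  open ≡-Reasoning
  ∸-∸ : ∀ x → x ∸ j ∸ g ≡ x ∸ (g + j)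
  ∸-∸ x = trans (ℕₚ.∸-+-assoc x j g) (cong (x ∸_) (ℕₚ.+-comm j g))
... | no g≰k∸j = trans (if-no _ (g <? suc (k ∸ j)) (g≰k∸j ∘ ℕₚ.≤-pred))
  (sym (if-no _ (g + j <? suc k) (g≰k∸j ∘ ℕₚ.m+n≤o⇒m≤o∸n g ∘ ℕₚ.≤-pred)))

hWeight-vanishes : (r k a : ℕ) → k < a → hWeight r k a ≡ 0ℤ
hWeight-vanishes r k a k<a = if-no _ (a <? suc k) (ℕₚ.<⇒≱ k<a ∘ ℕₚ.≤-pred)

xpow*-≤ : (j : ℕ) (p : Poly) (k : ℕ) → j ≤ k → xpow* j p k ≡ p (k ∸ j)
xpow*-≤ j p k j≤k with j ≤? k
... | yes _   = refl
... | no j≰k = contradiction j≤k j≰k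

xpow*-> : (j : ℕ) (p : Poly) (k : ℕ) → k < j → xpow* j p k ≡ 0ℤ
xpow*-> j p k k<j with j ≤? k
... | yes j≤k = contradiction j≤k (ℕₚ.<⇒≱ k<j)
... | no _    = refl

∈-allSubsets : {n : ℕ} (A : Subset n) → A ∈ˡ allSubsets n
∈-allSubsets []          = here refl
∈-allSubsets (true ∷ A)  = ∈-++⁺ˡ (∈-map⁺ (true ∷_) (∈-allSubsets A))
∈-allSubsets (false ∷ A) = ∈-++⁺ʳ _ (∈-map⁺ (false ∷_) (∈-allSubsets A))

sum-allSubsets-suc : (n : ℕ) (f : Subset (suc n) → ℤ) →
  Sum (allSubsets (suc n)) f ≡ Sum (allSubsets n) (f ∘ (true ∷_)) +ℤ Sum (allSubsets n) (f ∘ (false ∷_))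
sum-allSubsets-suc n f = trans (sum-++ (map (true ∷_) (allSubsets n)) _ f)
  (cong₂ _+ℤ_ (sum-map (true ∷_) (allSubsets n) f) (sum-map (false ∷_) (allSubsets n) f))

sum-allSubsets-++ : (d : ℕ) {m : ℕ} (f : Subset (d + m) → ℤ) →
  Sum (allSubsets (d + m)) f ≡ ∑[ G ← allSubsets d ] ∑[ I ← allSubsets m ] f (G ++ I)
sum-allSubsets-++ zero    f = sym (ℤₚ.+-identityʳ _)
sum-allSubsets-++ (suc d) f = begin
  Sum (allSubsets (suc d + _)) f
    ≡⟨ sum-allSubsets-suc (d + _) f ⟩
  Sum (allSubsets (d + _)) (f ∘ (true ∷_)) +ℤ Sum (allSubsets (d + _)) (f ∘ (false ∷_))
    ≡⟨ cong₂ _+ℤ_ (sum-allSubsets-++ d (f ∘ (true ∷_))) (sum-allSubsets-++ d (f ∘ (false ∷_))) ⟩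
  Sum (allSubsets d) (F ∘ (true ∷_)) +ℤ Sum (allSubsets d) (F ∘ (false ∷_))
    ≡⟨ sym (sum-allSubsets-suc d F) ⟩
  Sum (allSubsets (suc d)) F ∎
  where
  open ≡-Reasoning
  F : Subset (suc d) → ℤ
  F G = ∑[ I ← allSubsets _ ] f (G ++ I)

∣++∣ : {d m : ℕ} (G : Subset d) (I : Subset m) → ∣ G ++ I ∣ ≡ ∣ G ∣ + ∣ I ∣
∣++∣ []          I = refl
∣++∣ (true ∷ G)  I = cong suc (∣++∣ G I)
∣++∣ (false ∷ G) I = ∣++∣ G I

∣firstD∣ : (d m : ℕ) → ∣ firstD d m ∣ ≡ d
∣firstD∣ d m = begin
  ∣ replicate d true ++ replicate m false ∣ ≡⟨ ∣++∣ (replicate d true) (replicate m false) ⟩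
  ∣ replicate d true ∣ + ∣ replicate m false ∣ ≡⟨ cong₂ _+_ (Subsetₚ.∣⊤∣≡n d) (Subsetₚ.∣⊥∣≡0 m) ⟩
  d + 0 ≡⟨ ℕₚ.+-identityʳ d ⟩
  d ∎
  where open ≡-Reasoning

∣embedTail∣ : (d : ℕ) {m : ℕ} (I : Subset m) → ∣ embedTail d I ∣ ≡ ∣ I ∣
∣embedTail∣ d I = trans (∣++∣ (replicate d false) I) (cong (_+ ∣ I ∣) (Subsetₚ.∣⊥∣≡0 d))

embedTail-⊆ : {d m : ℕ} (G : Subset d) (I : Subset m) → embedTail d I ⊆ G ++ I
embedTail-⊆ []      I = id
embedTail-⊆ (_ ∷ G) I = Subsetₚ.out⊆ (embedTail-⊆ G I)

∪-⁅⁆-head : (d : ℕ) {m : ℕ} (G : Subset d) (I : Subset m) (x : Fin (d + m)) → x ∈ firstD d m → x ∉ G ++ I →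
            Σ (Subset d) λ G' → (G ++ I) ∪ ⁅ x ⁆ ≡ G' ++ I × ∣ G' ∣ ≡ suc ∣ G ∣
∪-⁅⁆-head zero    G           I x        x∈firstD         _      = ⊥-elim (Subsetₚ.∉⊥ x∈firstD)
∪-⁅⁆-head (suc d) (true ∷ G)  I fzero    _                x∉G++I = contradiction here x∉G++I
∪-⁅⁆-head (suc d) (false ∷ G) I fzero    _                _      =
  true ∷ G , cong (true ∷_) (Subsetₚ.∪-identityʳ (G ++ I)) , refl
∪-⁅⁆-head (suc d) (b ∷ G)     I (fsuc x) (there x∈firstD) x∉G++I
  with ∪-⁅⁆-head d G I x x∈firstD (x∉G++I ∘ there)
... | G' , eq , ∣G'∣≡1+∣G∣ = b ∷ G' , cong₂ _∷_ (Boolₚ.∨-identityʳ b) eq , size b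
  where
  size : ∀ b → ∣ b ∷ G' ∣ ≡ suc ∣ b ∷ G ∣
  size true  = cong suc ∣G'∣≡1+∣G∣
  size false = ∣G'∣≡1+∣G∣

rank-≤ : {n : ℕ} (M : SetSystem n) (R : ℕ) → (∀ A → Indep M A → ∣ A ∣ ≤ R) → rank M ≤ R
rank-≤ {n} M R bound = foldr-preservesᵇ {P = _≤ R} ℕₚ.⊔-lub z≤n
  (Allₚ.map⁺ (All.map (bound _) (Allₚ.all-filter (indep? M) (allSubsets n))))

≤-rank : {n : ℕ} (M : SetSystem n) {A : Subset n} → Indep M A → ∣ A ∣ ≤ rank M
≤-rank {n} M {A} indepA = foldr-preservesᵒ {P = ∣ A ∣ ≤_}
  (λ x y → [ ℕₚ.m≤n⇒m≤n⊔o y , ℕₚ.m≤n⇒m≤o⊔n x ]) 0 _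
  (inj₂ (Any.map ℕₚ.≤-reflexive (∈-map⁺ ∣_∣ (∈-filter⁺ (indep? M) (∈-allSubsets A) indepA))))

rank-≡ : {n : ℕ} (M : SetSystem n) (R : ℕ) → (∀ A → Indep M A → ∣ A ∣ ≤ R) →
         (Σ (Subset n) λ A → Indep M A × ∣ A ∣ ≡ R) → rank M ≡ R
rank-≡ M R bound (A , indepA , ∣A∣≡R) =
  ℕₚ.≤-antisym (rank-≤ M R bound) (subst (_≤ rank M) ∣A∣≡R (≤-rank M indepA))

hpoly-of-rank : {n : ℕ} (M : SetSystem n) {r : ℕ} → rank M ≡ r → (k : ℕ) →
                hpoly M k ≡ ∑[ A ← allSubsets n ] (hWeight r k ∣ A ∣ if indep? M A)
hpoly-of-rank {n} M refl k =
  trans (hpoly-as-weighted-sum M k) (sum-filter (indep? M) (allSubsets n) (λ A → hWeight (rank M) k ∣ A ∣))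

module _ {n : ℕ} (M : SetSystem n) (R : ℕ)
         (augment : ∀ A → Indep M A → ∣ A ∣ < R → Σ (Subset n) λ A' → Indep M A' × ∣ A' ∣ ≡ suc ∣ A ∣)
         where

  augment-to : ∀ t A → Indep M A → t + ∣ A ∣ ≡ R → Σ (Subset n) λ A' → Indep M A' × ∣ A' ∣ ≡ R
  augment-to zero    A indepA eq = A , indepA , eq
  augment-to (suc t) A indepA eq with augment A indepA (subst (∣ A ∣ <_) eq (s≤s (ℕₚ.m≤n+m ∣ A ∣ t)))
  ... | A' , indepA' , ∣A'∣≡1+∣A∣ =
    augment-to t A' indepA' (trans (cong (λ s → t + s) ∣A'∣≡1+∣A∣) (trans (ℕₚ.+-suc t ∣ A ∣) eq))

module _ {n : ℕ} {M : SetSystem n} (isMatroid : IsMatroid M) {B : Subset n} (basis : IsBasis M B) where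
  open IsMatroid isMatroid

  ∣indep∣≤∣basis∣ : ∀ {A} → Indep M A → ∣ A ∣ ≤ ∣ B ∣
  ∣indep∣≤∣basis∣ {A} indepA = ℕₚ.≮⇒≥ basis-not-augmentable
    where
    basis-not-augmentable : ¬ (∣ B ∣ < ∣ A ∣)
    basis-not-augmentable ∣B∣<∣A∣ with exchange B A (proj₁ basis) indepA ∣B∣<∣A∣
    ... | x , _ , x∉B , indepB∪x = x∉B (subst (x ∈_) B∪x≡B (Subsetₚ.x∈p∪q⁺ (inj₂ (Subsetₚ.x∈⁅x⁆ x))))
      where
      B∪x≡B : B ∪ ⁅ x ⁆ ≡ B
      B∪x≡B = proj₂ basis _ indepB∪x (Subsetₚ.p⊆p∪q ⁅ x ⁆)

  rank-≡-∣basis∣ : rank M ≡ ∣ B ∣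
  rank-≡-∣basis∣ = rank-≡ M ∣ B ∣ (λ _ → ∣indep∣≤∣basis∣) (B , proj₁ basis , refl)

module FirstBasis (d m : ℕ) (Δ : SetSystem (d + m)) (isMatroid : IsMatroid Δ) (basis : IsBasis Δ (firstD d m)) where
  open IsMatroid isMatroid

  ∣indep∣≤d : ∀ {A} → Indep Δ A → ∣ A ∣ ≤ d
  ∣indep∣≤d {A} indepA = subst (∣ A ∣ ≤_) (∣firstD∣ d m) (∣indep∣≤∣basis∣ isMatroid basis indepA)

  rank-Δ : rank Δ ≡ d
  rank-Δ = trans (rank-≡-∣basis∣ isMatroid basis) (∣firstD∣ d m)

  module _ (I : Subset m) (indepI : Indep Δ (embedTail d I)) where

    -- Exchanging against the basis [d] adds an element of [d], so the result is again of the form G' ++ I.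
    Gamma-augment : ∀ G → Indep Δ (G ++ I) → ∣ G ∣ < d ∸ ∣ I ∣ →
                    Σ (Subset d) λ G' → Indep Δ (G' ++ I) × ∣ G' ∣ ≡ suc ∣ G ∣
    Gamma-augment G indepG ∣G∣<d∸∣I∣ with exchange (G ++ I) (firstD d m) indepG (proj₁ basis) ∣G++I∣<∣firstD∣
      where
      ∣I∣≤d : ∣ I ∣ ≤ d
      ∣I∣≤d = subst (_≤ d) (∣embedTail∣ d I) (∣indep∣≤d indepI)
      ∣G++I∣<∣firstD∣ : ∣ G ++ I ∣ < ∣ firstD d m ∣
      ∣G++I∣<∣firstD∣ = subst₂ _<_ (sym (∣++∣ G I)) (sym (∣firstD∣ d m))
                                   (ℕₚ.m≤o∸n⇒m+n≤o (suc ∣ G ∣) ∣I∣≤d ∣G∣<d∸∣I∣)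
    ... | x , x∈firstD , x∉G++I , indepG++I∪x with ∪-⁅⁆-head d G I x x∈firstD x∉G++I
    ... | G' , eq , ∣G'∣≡1+∣G∣ = G' , subst (Indep Δ) eq indepG++I∪x , ∣G'∣≡1+∣G∣

    rank-Gamma : rank (Gamma Δ I) ≡ d ∸ ∣ I ∣
    rank-Gamma = rank-≡ (Gamma Δ I) (d ∸ ∣ I ∣) bound
      (augment-to (Gamma Δ I) (d ∸ ∣ I ∣) Gamma-augment (d ∸ ∣ I ∣) ⊥ indepI ∣⊥∣-deficiency)
      where
      bound : ∀ G → Indep Δ (G ++ I) → ∣ G ∣ ≤ d ∸ ∣ I ∣
      bound G indepG = ℕₚ.m+n≤o⇒m≤o∸n ∣ G ∣ (subst (_≤ d) (∣++∣ G I) (∣indep∣≤d indepG))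
      ∣⊥∣-deficiency : d ∸ ∣ I ∣ + ∣ ⊥ {d} ∣ ≡ d ∸ ∣ I ∣
      ∣⊥∣-deficiency = trans (cong (λ s → d ∸ ∣ I ∣ + s) (Subsetₚ.∣⊥∣≡0 d)) (ℕₚ.+-identityʳ _)

  fibre-sum-indep : (k : ℕ) (I : Subset m) → Indep Δ (embedTail d I) →
    ∑[ G ← allSubsets d ] (hWeight d k ∣ G ++ I ∣ if indep? Δ (G ++ I)) ≡ xpow* ∣ I ∣ (hpoly (Gamma Δ I)) k
  fibre-sum-indep k I indepI with ℕₚ.≤-<-connex ∣ I ∣ k
  ... | inj₁ ∣I∣≤k = sym (begin
    xpow* ∣ I ∣ (hpoly (Gamma Δ I)) k
      ≡⟨ xpow*-≤ ∣ I ∣ _ k ∣I∣≤k ⟩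
    hpoly (Gamma Δ I) (k ∸ ∣ I ∣)
      ≡⟨ hpoly-of-rank (Gamma Δ I) (rank-Gamma I indepI) (k ∸ ∣ I ∣) ⟩
    ∑[ G ← allSubsets d ] (hWeight (d ∸ ∣ I ∣) (k ∸ ∣ I ∣) ∣ G ∣ if indep? Δ (G ++ I))
      ≡⟨ sum-cong (allSubsets d) (λ G → cong (_if indep? Δ (G ++ I)) (shift G)) ⟩
    ∑[ G ← allSubsets d ] (hWeight d k ∣ G ++ I ∣ if indep? Δ (G ++ I)) ∎)
    where
    open ≡-Reasoning
    shift : ∀ G → hWeight (d ∸ ∣ I ∣) (k ∸ ∣ I ∣) ∣ G ∣ ≡ hWeight d k ∣ G ++ I ∣
    shift G = trans (hWeight-shift d k ∣ I ∣ ∣ G ∣ ∣I∣≤k) (cong (hWeight d k) (sym (∣++∣ G I)))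
  ... | inj₂ k<∣I∣ = trans (sum-zero (allSubsets d) vanishes) (sym (xpow*-> ∣ I ∣ _ k k<∣I∣))
    where
    vanishes : ∀ G → hWeight d k ∣ G ++ I ∣ if indep? Δ (G ++ I) ≡ 0ℤ
    vanishes G = trans (cong (_if indep? Δ (G ++ I)) (hWeight-vanishes d k _ k<∣G++I∣)) (0-if (indep? Δ (G ++ I)))
      where
      k<∣G++I∣ : k < ∣ G ++ I ∣
      k<∣G++I∣ = ℕₚ.<-≤-trans k<∣I∣ (subst (∣ I ∣ ≤_) (sym (∣++∣ G I)) (ℕₚ.m≤n+m ∣ I ∣ ∣ G ∣))

  fibre-sum : (k : ℕ) (I : Subset m) →
    ∑[ G ← allSubsets d ] (hWeight d k ∣ G ++ I ∣ if indep? Δ (G ++ I))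
      ≡ xpow* ∣ I ∣ (hpoly (Gamma Δ I)) k if indep? Δ (embedTail d I)
  fibre-sum k I with indep? Δ (embedTail d I)
  ... | yes indepI = fibre-sum-indep k I indepI
  ... | no ¬indepI = sum-zero (allSubsets d)
    (λ G → if-no _ (indep? Δ (G ++ I)) (¬indepI ∘ hereditary _ _ (embedTail-⊆ G I)))

mainTheorem4 : (d m : ℕ) (Δ : SetSystem (d + m)) → IsMatroid Δ →
    IsBasis Δ (firstD d m) →
    ∀ k → hpoly Δ k ≡ sumₚ (map (λ I → xpow* ∣ I ∣ (hpoly (Gamma Δ I))) (tailIndepSets d Δ)) k
mainTheorem4 d m Δ isMatroid basis k = begin
  hpoly Δ k
    ≡⟨ hpoly-of-rank Δ rank-Δ k ⟩
  ∑[ A ← allSubsets (d + m) ] (hWeight d k ∣ A ∣ if indep? Δ A)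
    ≡⟨ sum-allSubsets-++ d _ ⟩
  ∑[ G ← allSubsets d ] ∑[ I ← allSubsets m ] (hWeight d k ∣ G ++ I ∣ if indep? Δ (G ++ I))
    ≡⟨ sum-swap (allSubsets d) (allSubsets m) _ ⟩
  ∑[ I ← allSubsets m ] ∑[ G ← allSubsets d ] (hWeight d k ∣ G ++ I ∣ if indep? Δ (G ++ I))
    ≡⟨ sum-cong (allSubsets m) (fibre-sum k) ⟩
  ∑[ I ← allSubsets m ] (contribution I k if indep? Δ (embedTail d I))
    ≡⟨ sum-filter (λ I → indep? Δ (embedTail d I)) (allSubsets m) (λ I → contribution I k) ⟨
  ∑[ I ← tailIndepSets d Δ ] contribution I k
    ≡⟨ sumₚ-apply (tailIndepSets d Δ) contribution k ⟨
  sumₚ (map contribution (tailIndepSets d Δ)) k ∎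
  where
  open ≡-Reasoning
  open FirstBasis d m Δ isMatroid basis
  contribution : Subset m → Poly
  contribution I = xpow* ∣ I ∣ (hpoly (Gamma Δ I))
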